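{- Let $G$ be a connected graph and $e\in E(G)$. Then $$\chi_d^t(G)-2\leq \chi_d^t(G/e)\leq \chi_d^t(G)+1.$$
   Context: All graphs are simple and finite. For a graph with no isolated vertex, a total dominator coloring (TD-coloring) is a proper vertex coloring in which every vertex is adjacent to every vertex of some color class (a class other than its own); $\chi_d^t$ denotes the minimum number of colors in such a coloring. For an edge $e=uv$, the contraction $G/e$ is obtained by replacing $u$ and $v$ by a single new vertex adjacent to every vertex (other than $u,v$) that was adjacent to $u$ or $v$ (no parallel edges or loops). Implicitly, every graph whose $\chi_d^t$ appears has no isolated vertex. -}

module Defs where

open import Data.Nat using (ℕ; suc)
open import Data.Fin using (Fin; punchIn)
open import Data.Product using (Σ; ∃; _×_; _,_)
open import Data.Sum using (_⊎_; inj₁; inj₂)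
open import Relation.Binary.PropositionalEquality using (_≡_; _≢_; refl; sym)
open import Relation.Nullary using (¬_)

record Graph (n : ℕ) : Set₁ where
  field
    Adj     : Fin n → Fin n → Set
    symAdj  : ∀ {x y} → Adj x y → Adj y x
    irrefl  : ∀ {x} → ¬ Adj x x
open Graph public

data Reach {n : ℕ} (G : Graph n) : Fin n → Fin n → Set where
  here : ∀ {x} → Reach G x x
  step : ∀ {x y z} → Adj G x y → Reach G y z → Reach G x z

Connected : ∀ {n} → Graph n → Set
Connected G = ∀ x y → Reach G x y

NoIsolated : ∀ {n} → Graph n → Set
NoIsolated {n} G = ∀ x → ∃ λ y → Adj G x y

-- A coloring with k colors (classes may a priori be empty).
Coloring : ℕ → ℕ → Set
Coloring n k = Fin n → Fin k

Proper : ∀ {n k} → Graph n → Coloring n k → Set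
Proper G c = ∀ {x y} → Adj G x y → c x ≢ c y

DominatesClass : ∀ {n k} → Graph n → Coloring n k → Fin n → Fin k → Set
DominatesClass {n} G c v i = (∃ λ u → c u ≡ i) × (∀ u → c u ≡ i → Adj G v u)

-- Total dominator coloring: proper, and every vertex is adjacent to every
-- vertex of some (nonempty) color class.  (Such a class is automatically
-- different from the vertex's own class, by irreflexivity.)
IsTDColoring : ∀ {n k} → Graph n → Coloring n k → Set
IsTDColoring {n} {k} G c = Proper G c × (∀ v → ∃ λ (i : Fin k) → DominatesClass G c v i)

HasTDColoring : ∀ {n} → Graph n → ℕ → Set
HasTDColoring {n} G k = ∃ λ (c : Coloring n k) → IsTDColoring G c

IsTDChromatic : ∀ {n} → Graph n → ℕ → Set
IsTDChromatic G k = HasTDColoring G k × (∀ m → HasTDColoring G m → k Data.Nat.≤ m)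

-- The vertices of G/e are Fin n, embedded into Fin (suc n) via punchIn v
-- (i.e. all vertices except v); the vertex u plays the role of the merged vertex.
ContrAdj : ∀ {n} (G : Graph (suc n)) (u v : Fin (suc n)) → Fin n → Fin n → Set
ContrAdj G u v x y =
  x ≢ y ×
  (Adj G (punchIn v x) (punchIn v y)
   ⊎ (punchIn v x ≡ u × Adj G v (punchIn v y))
   ⊎ (punchIn v y ≡ u × Adj G (punchIn v x) v))

private
  ≢-sym : ∀ {A : Set} {a b : A} → a ≢ b → b ≢ a
  ≢-sym p q = p (sym q)

  contrSym : ∀ {n} (G : Graph (suc n)) (u v : Fin (suc n)) {x y : Fin n} →
             ContrAdj G u v x y → ContrAdj G u v y x
  contrSym G u v (ne , inj₁ a) = ≢-sym ne , inj₁ (symAdj G a)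
  contrSym G u v (ne , inj₂ (inj₁ (e , a))) = ≢-sym ne , inj₂ (inj₂ (e , symAdj G a))
  contrSym G u v (ne , inj₂ (inj₂ (e , a))) = ≢-sym ne , inj₂ (inj₁ (e , symAdj G a))

contract : ∀ {n} (G : Graph (suc n)) (u v : Fin (suc n)) → Adj G u v → Graph n
contract G u v _ = record
  { Adj    = ContrAdj G u v
  ; symAdj = contrSym G u v
  ; irrefl = λ { (ne , _) → ne refl }
  }

-- Both bounds come from explicit recolourings, driven by vertices that are
-- alone in their colour class: such a vertex is dominated by each of its
-- neighbours and cannot clash with any of them.
--
-- From a TD-colouring of G/e, give u and v two fresh colours and keep the
-- others: a vertex that dominated a class through the merged vertex now
-- dominates the singleton class of u or of v.
--
-- From a TD-colouring of G, look at the classes dominated by u and by v.  If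
-- one of them contains a vertex other than u and v, give the merged vertex a
-- fresh colour; it then dominates what is left of that class.  Otherwise u
-- and v are alone in their classes; the merged vertex keeps the colour of u,
-- and one of its neighbours y₀ takes over the colour of v.

module Submission where

open import Defs
open import Data.Nat using (ℕ; suc; _+_; _≤_)
import Data.Nat.Properties as ℕ
open import Data.Fin as Fin using (Fin; zero; suc; punchIn; punchOut; _≟_)
open import Data.Fin.Properties
  using (suc-injective; 0≢1+n; punchIn-injective; punchInᵢ≢i; punchIn-punchOut; any?)
open import Data.Vec.Functional using (updateAt; insertAt)
open import Data.Vec.Functional.Properties
  using (updateAt-updates; updateAt-minimal; insertAt-lookup; insertAt-punchIn)
open import Data.Product using (_×_; _,_; ∃; proj₂)
open import Data.Sum using (_⊎_; inj₁; inj₂; [_,_]′)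
open import Function using (_∘_; const)
open import Relation.Nullary using (¬_; yes; no; contradiction)
open import Relation.Nullary.Decidable using (¬?; _×-dec_)
open import Relation.Binary.PropositionalEquality
  using (_≡_; _≢_; refl; sym; trans; cong; subst; subst₂; ≢-sym)

data PunchInView {n} (i : Fin (suc n)) : Fin (suc n) → Set where
  pivot   : PunchInView i i
  punched : ∀ j → PunchInView i (punchIn i j)

punchInView : ∀ {n} (i y : Fin (suc n)) → PunchInView i y
punchInView i y with i ≟ y
... | yes refl = pivot
... | no i≢y   = subst (PunchInView i) (punchIn-punchOut i≢y) (punched (punchOut i≢y))

SoleInClass : ∀ {n k} → Coloring n k → Fin n → Set
SoleInClass c z = ∀ y → c y ≡ c z → y ≡ z

module _ {n k} (G : Graph n) {c : Coloring n k} {x z : Fin n}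
         (sole : SoleInClass c z) (x~z : Adj G x z) where

  sole-proper : c x ≢ c z
  sole-proper cx≡cz = irrefl G (subst (Adj G x) (sym (sole x cx≡cz)) x~z)

  sole-dominated : DominatesClass G c x (c z)
  sole-dominated = (z , refl) , λ y cy≡cz → subst (Adj G x) (sym (sole y cy≡cz)) x~z

sole-if-no-other : ∀ {n k} {c : Coloring n k} {z a i} →
                   c a ≡ i → ¬ (∃ λ x → x ≢ z × c x ≡ i) → SoleInClass c z
sole-if-no-other {z = z} {a} ca≡i no-other y cy≡cz with a ≟ z | y ≟ z
... | _        | yes y≡z = y≡z
... | no a≢z   | _       = contradiction (a , a≢z , ca≡i) no-other
... | yes refl | no y≢z  = contradiction (y , y≢z , trans cy≡cz ca≡i) no-other

sole-updateAt : ∀ {n k} (f : Coloring n k) i {a} →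
                (∀ x → x ≢ i → f x ≢ a) → SoleInClass (updateAt f i (const a)) i
sole-updateAt f i fresh y eq with y ≟ i
... | yes y≡i = y≡i
... | no y≢i  = contradiction
  (trans (sym (updateAt-minimal y i f y≢i)) (trans eq (updateAt-updates i f)))
  (fresh y y≢i)

sole-insertAt : ∀ {n k} (f : Coloring n k) i {a} →
                (∀ x → f x ≢ a) → SoleInClass (insertAt f i a) i
sole-insertAt f i {a} fresh y eq with punchInView i y
... | pivot     = refl
... | punched x = contradiction
  (trans (sym (insertAt-punchIn f i a x)) (trans eq (insertAt-lookup f i a)))
  (fresh x)

sole-insertAt-punchIn : ∀ {n k} (f : Coloring n k) i {a z} → (∀ x → f x ≢ a) →
                        SoleInClass f z → SoleInClass (insertAt f i a) (punchIn i z)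
sole-insertAt-punchIn f i {a} {z} fresh sole y eq with punchInView i y
... | pivot     = contradiction
  (trans (sym (insertAt-lookup f i a)) (trans eq (insertAt-punchIn f i a z)))
  (≢-sym (fresh z))
... | punched x = cong (punchIn i)
  (sole x (trans (sym (insertAt-punchIn f i a x)) (trans eq (insertAt-punchIn f i a z))))

module Contraction {n} (G : Graph (suc n)) (u v : Fin (suc n)) (e : Adj G u v) where

  H : Graph n
  H = contract G u v e

  ι : Fin n → Fin (suc n)
  ι = punchIn v

  u≢v : u ≢ v
  u≢v u≡v = irrefl G (subst (Adj G u) (sym u≡v) e)

  -- The merged vertex of H, i.e. u seen as a vertex of G - v.
  w : Fin n
  w = punchOut (≢-sym u≢v)

  ιw≡u : ι w ≡ u
  ιw≡u = punchIn-punchOut (≢-sym u≢v)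

  ι≡u⇒≡w : ∀ {x} → ι x ≡ u → x ≡ w
  ι≡u⇒≡w ιx≡u = punchIn-injective v _ w (trans ιx≡u (sym ιw≡u))

  ι≢v : ∀ x → ι x ≢ v
  ι≢v = punchInᵢ≢i v

  data VertexH : Fin n → Set where
    merged : VertexH w
    kept   : ∀ x → x ≢ w → VertexH x

  vertexH : ∀ x → VertexH x
  vertexH x with x ≟ w
  ... | yes refl = merged
  ... | no x≢w   = kept x x≢w

  data VertexG : Fin (suc n) → Set where
    endpoint-v : VertexG v
    endpoint-u : VertexG u
    kept       : ∀ x → x ≢ w → VertexG (ι x)

  vertexG : ∀ z → VertexG z
  vertexG z with punchInView v z
  ... | pivot = endpoint-v
  ... | punched x with vertexH x
  ...   | merged     = subst VertexG (sym ιw≡u) endpoint-u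
  ...   | kept x x≢w = kept x x≢w

  kept-of : ∀ {z} → z ≢ u → z ≢ v → ∃ λ x → x ≢ w × ι x ≡ z
  kept-of {z} z≢u z≢v with vertexG z
  ... | endpoint-v = contradiction refl z≢v
  ... | endpoint-u = contradiction refl z≢u
  ... | kept x x≢w = x , x≢w , refl

  AdjEndpoint : Fin (suc n) → Set
  AdjEndpoint z = Adj G z u ⊎ Adj G z v

  contract-adj : ∀ {x y} → Adj G (ι x) (ι y) → Adj H x y
  contract-adj a = (λ { refl → irrefl G a }) , inj₁ a

  expand-adj : ∀ {x y} → Adj H x y → x ≢ w → y ≢ w → Adj G (ι x) (ι y)
  expand-adj (_ , inj₁ a)                 _   _   = a
  expand-adj (_ , inj₂ (inj₁ (ιx≡u , _))) x≢w _   = contradiction (ι≡u⇒≡w ιx≡u) x≢w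
  expand-adj (_ , inj₂ (inj₂ (ιy≡u , _))) _   y≢w = contradiction (ι≡u⇒≡w ιy≡u) y≢w

  contract-adj-endpoint : ∀ {x} → x ≢ w → AdjEndpoint (ι x) → Adj H x w
  contract-adj-endpoint x≢w (inj₁ ιx~u) = x≢w , inj₁ (subst (Adj G _) (sym ιw≡u) ιx~u)
  contract-adj-endpoint x≢w (inj₂ ιx~v) = x≢w , inj₂ (inj₂ (ιw≡u , ιx~v))

  expand-adj-endpoint : ∀ {x} → Adj H x w → x ≢ w → AdjEndpoint (ι x)
  expand-adj-endpoint (_ , inj₁ a)                 _   = inj₁ (subst (Adj G _) ιw≡u a)
  expand-adj-endpoint (_ , inj₂ (inj₁ (ιx≡u , _))) x≢w = contradiction (ι≡u⇒≡w ιx≡u) x≢w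
  expand-adj-endpoint (_ , inj₂ (inj₂ (_ , a)))    _   = inj₂ a

  module Uncontract {k′} (c′ : Coloring n k′) (proper′ : Proper H c′)
                    (dominated′ : ∀ x → ∃ λ i → DominatesClass H c′ x i) where

    shifted : Coloring n (suc (suc k′))
    shifted x = suc (suc (c′ x))

    c″ : Coloring n (suc (suc k′))
    c″ = updateAt shifted w (const zero)

    c : Coloring (suc n) (suc (suc k′))
    c = insertAt c″ v (suc zero)

    c″≢1 : ∀ x → c″ x ≢ suc zero
    c″≢1 x c″x≡1 with x ≟ w
    ... | yes refl = 0≢1+n (trans (sym (updateAt-updates w shifted)) c″x≡1)
    ... | no x≢w   = 0≢1+n (sym (suc-injective
                      (trans (sym (updateAt-minimal x w shifted x≢w)) c″x≡1)))

    c-kept : ∀ {x} → x ≢ w → c (ι x) ≡ suc (suc (c′ x))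
    c-kept {x} x≢w = trans (insertAt-punchIn c″ v (suc zero) x)
                           (updateAt-minimal x w shifted x≢w)

    sole-v : SoleInClass c v
    sole-v = sole-insertAt c″ v c″≢1

    sole-u : SoleInClass c u
    sole-u = subst (SoleInClass c) ιw≡u
      (sole-insertAt-punchIn c″ v c″≢1 (sole-updateAt shifted w (λ _ _ ())))

    proper : Proper G c
    proper {y} {z} a with vertexG y | vertexG z
    ... | endpoint-v | _          = ≢-sym (sole-proper G sole-v (symAdj G a))
    ... | endpoint-u | _          = ≢-sym (sole-proper G sole-u (symAdj G a))
    ... | kept _ _   | endpoint-v = sole-proper G sole-v a
    ... | kept _ _   | endpoint-u = sole-proper G sole-u a
    ... | kept x x≢w | kept y y≢w = subst₂ _≢_ (sym (c-kept x≢w)) (sym (c-kept y≢w))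
      (proper′ (contract-adj a) ∘ suc-injective ∘ suc-injective)

    dominated-kept : ∀ x → x ≢ w → ∃ λ i → DominatesClass G c (ι x) i
    dominated-kept x x≢w with dominated′ x
    ... | i , (x₀ , c′x₀≡i) , x~i with c′ w ≟ i
    ...   | yes c′w≡i with expand-adj-endpoint (x~i w c′w≡i) x≢w
    ...     | inj₁ ιx~u = c u , sole-dominated G sole-u ιx~u
    ...     | inj₂ ιx~v = c v , sole-dominated G sole-v ιx~v
    dominated-kept x x≢w | i , (x₀ , c′x₀≡i) , x~i | no c′w≢i =
      suc (suc i) , (ι x₀ , cιx₀≡i) , ιx~i
      where
        x₀≢w : x₀ ≢ w
        x₀≢w refl = c′w≢i c′x₀≡i

        cιx₀≡i : c (ι x₀) ≡ suc (suc i)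
        cιx₀≡i = trans (c-kept x₀≢w) (cong (Fin.suc ∘ Fin.suc) c′x₀≡i)

        ιx~i : ∀ z → c z ≡ suc (suc i) → Adj G (ι x) z
        ιx~i z cz≡i with vertexG z
        ... | endpoint-v = contradiction (sole-v (ι x₀) (trans cιx₀≡i (sym cz≡i))) (ι≢v x₀)
        ... | endpoint-u =
          contradiction (ι≡u⇒≡w (sole-u (ι x₀) (trans cιx₀≡i (sym cz≡i)))) x₀≢w
        ... | kept y y≢w = expand-adj
          (x~i y (suc-injective (suc-injective (trans (sym (c-kept y≢w)) cz≡i)))) x≢w y≢w

    dominated : ∀ z → ∃ λ i → DominatesClass G c z i
    dominated z with vertexG z
    ... | endpoint-v = c u , sole-dominated G sole-u (symAdj G e)
    ... | endpoint-u = c v , sole-dominated G sole-v e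
    ... | kept x x≢w = dominated-kept x x≢w

  module Contract {k} (c : Coloring (suc n) k) (proper : Proper G c)
                  (dominated : ∀ z → ∃ λ i → DominatesClass G c z i) where

    adj-merged⊎avoiding : ∀ x → x ≢ w →
      Adj H x w ⊎ ∃ λ l → c u ≢ l × c v ≢ l × DominatesClass G c (ι x) l
    adj-merged⊎avoiding x x≢w with dominated (ι x)
    ... | l , ιx-dom@(_ , ιx~l) with c u ≟ l | c v ≟ l
    ...   | yes cu≡l | _        = inj₁ (contract-adj-endpoint x≢w (inj₁ (ιx~l u cu≡l)))
    ...   | no _     | yes cv≡l = inj₁ (contract-adj-endpoint x≢w (inj₂ (ιx~l v cv≡l)))
    ...   | no cu≢l  | no cv≢l  = inj₂ (l , cu≢l , cv≢l , ιx-dom)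

    module FreshMergedColour (i : Fin k) {x₀} (x₀≢u : x₀ ≢ u) (x₀≢v : x₀ ≢ v)
                             (cx₀≡i : c x₀ ≡ i)
                             (i~endpoint : ∀ z → c z ≡ i → AdjEndpoint z) where

      shifted : Coloring n (suc k)
      shifted x = suc (c (ι x))

      d : Coloring n (suc k)
      d = updateAt shifted w (const zero)

      d-kept : ∀ {x} → x ≢ w → d x ≡ suc (c (ι x))
      d-kept {x} x≢w = updateAt-minimal x w shifted x≢w

      d≡suc⇒≢w : ∀ {x l} → d x ≡ suc l → x ≢ w
      d≡suc⇒≢w dx≡l refl = 0≢1+n (trans (sym (updateAt-updates w shifted)) dx≡l)

      sole-w : SoleInClass d w
      sole-w = sole-updateAt shifted w (λ _ _ ())

      proper-d : Proper H d
      proper-d {x} {y} a with vertexH x | vertexH y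
      ... | merged     | _          = ≢-sym (sole-proper H sole-w (symAdj H a))
      ... | kept _ _   | merged     = sole-proper H sole-w a
      ... | kept x x≢w | kept y y≢w = subst₂ _≢_ (sym (d-kept x≢w)) (sym (d-kept y≢w))
        (proper (expand-adj a x≢w y≢w) ∘ suc-injective)

      dominates-shifted : ∀ {x l z₀} → z₀ ≢ u → z₀ ≢ v → c z₀ ≡ l →
        (∀ y → y ≢ w → c (ι y) ≡ l → Adj H x y) → DominatesClass H d x (suc l)
      dominates-shifted z₀≢u z₀≢v cz₀≡l x~l with kept-of z₀≢u z₀≢v
      ... | y₀ , y₀≢w , refl = (y₀ , trans (d-kept y₀≢w) (cong suc cz₀≡l)) , λ y dy≡l →
        let y≢w = d≡suc⇒≢w dy≡l in
        x~l y y≢w (suc-injective (trans (sym (d-kept y≢w)) dy≡l))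

      dominated-d : ∀ x → ∃ λ i → DominatesClass H d x i
      dominated-d x with vertexH x
      ... | merged = suc i , dominates-shifted x₀≢u x₀≢v cx₀≡i λ y y≢w cιy≡i →
        symAdj H (contract-adj-endpoint y≢w (i~endpoint (ι y) cιy≡i))
      ... | kept x x≢w with adj-merged⊎avoiding x x≢w
      ...   | inj₁ x~w = d w , sole-dominated H sole-w x~w
      ...   | inj₂ (l , cu≢l , cv≢l , (a , ca≡l) , ιx~l) =
        suc l , dominates-shifted (λ { refl → cu≢l ca≡l }) (λ { refl → cv≢l ca≡l }) ca≡l
                  λ y _ cιy≡l → contract-adj (ιx~l (ι y) cιy≡l)

      has : HasTDColoring H (suc k)
      has = d , proper-d , dominated-d

    module ReuseEndpointColours (sole-u : SoleInClass c u) (sole-v : SoleInClass c v)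
                                {y₀} (w~y₀ : Adj H w y₀) where

      -- w keeps c (ι w) = c u, so only y₀ changes colour.
      d : Coloring n k
      d = updateAt (c ∘ ι) y₀ (const (c v))

      d-y₀ : d y₀ ≡ c v
      d-y₀ = updateAt-updates y₀ (c ∘ ι)

      d-other : ∀ {x} → x ≢ y₀ → d x ≡ c (ι x)
      d-other {x} x≢y₀ = updateAt-minimal x y₀ (c ∘ ι) x≢y₀

      y₀≢w : y₀ ≢ w
      y₀≢w refl = irrefl H w~y₀

      d-w : d w ≡ c u
      d-w = trans (d-other (≢-sym y₀≢w)) (cong c ιw≡u)

      sole-y₀ : SoleInClass d y₀
      sole-y₀ = sole-updateAt (c ∘ ι) y₀ λ x _ cιx≡cv → ι≢v x (sole-v (ι x) cιx≡cv)

      sole-w : SoleInClass d w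
      sole-w y dy≡dw with y ≟ y₀
      ... | yes refl = contradiction (sole-u v (trans (sym d-y₀) (trans dy≡dw d-w))) (≢-sym u≢v)
      ... | no y≢y₀  = ι≡u⇒≡w (sole-u (ι y) (trans (sym (d-other y≢y₀)) (trans dy≡dw d-w)))

      proper-d : Proper H d
      proper-d {x} {y} a with vertexH x | vertexH y
      ... | merged     | _          = ≢-sym (sole-proper H sole-w (symAdj H a))
      ... | kept _ _   | merged     = sole-proper H sole-w a
      ... | kept x x≢w | kept y y≢w with x ≟ y₀ | y ≟ y₀
      ...   | yes refl | _        = ≢-sym (sole-proper H sole-y₀ (symAdj H a))
      ...   | no _     | yes refl = sole-proper H sole-y₀ a
      ...   | no x≢y₀  | no y≢y₀  = subst₂ _≢_ (sym (d-other x≢y₀)) (sym (d-other y≢y₀))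
        (proper (expand-adj a x≢w y≢w))

      dominated-d : ∀ x → ∃ λ i → DominatesClass H d x i
      dominated-d x with vertexH x
      ... | merged = d y₀ , sole-dominated H sole-y₀ w~y₀
      ... | kept x x≢w with adj-merged⊎avoiding x x≢w
      ...   | inj₁ x~w = d w , sole-dominated H sole-w x~w
      ...   | inj₂ (l , cu≢l , cv≢l , (a , ca≡l) , ιx~l) with a ≟ ι y₀
      ...     | yes refl = d y₀ , sole-dominated H sole-y₀ (contract-adj (ιx~l (ι y₀) ca≡l))
      ...     | no a≢ιy₀ with kept-of {a} (λ { refl → cu≢l ca≡l }) (λ { refl → cv≢l ca≡l })
      ...       | a′ , _ , refl = l , (a′ , trans (d-other (a≢ιy₀ ∘ cong ι)) ca≡l) , x~l
        where
          x~l : ∀ y → d y ≡ l → Adj H x y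
          x~l y dy≡l with y ≟ y₀
          ... | yes refl = contradiction (trans (sym d-y₀) dy≡l) cv≢l
          ... | no y≢y₀  = contract-adj (ιx~l (ι y) (trans (sym (d-other y≢y₀)) dy≡l))

      has : HasTDColoring H k
      has = d , proper-d , dominated-d

    contracted-coloring : NoIsolated H → HasTDColoring H (suc k) ⊎ HasTDColoring H k
    contracted-coloring noIsolated with dominated u | dominated v
    ... | i , (a , ca≡i) , u~i | j , (b , cb≡j) , v~j
        with any? (λ x → ¬? (x ≟ v) ×-dec (c x ≟ i))
    ...   | yes (x₀ , x₀≢v , cx₀≡i) = inj₁ (FreshMergedColour.has i
            (λ { refl → irrefl G (u~i u cx₀≡i) }) x₀≢v cx₀≡i
            λ z cz≡i → inj₁ (symAdj G (u~i z cz≡i)))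
    ...   | no no-other-in-i with any? (λ x → ¬? (x ≟ u) ×-dec (c x ≟ j))
    ...     | yes (x₀ , x₀≢u , cx₀≡j) = inj₁ (FreshMergedColour.has j
              x₀≢u (λ { refl → irrefl G (v~j v cx₀≡j) }) cx₀≡j
              λ z cz≡j → inj₂ (symAdj G (v~j z cz≡j)))
    ...     | no no-other-in-j = inj₂ (ReuseEndpointColours.has
              (sole-if-no-other cb≡j no-other-in-j) (sole-if-no-other ca≡i no-other-in-i)
              (proj₂ (noIsolated w)))

  uncontracted-coloring : ∀ {k′} → HasTDColoring H k′ → HasTDColoring G (2 + k′)
  uncontracted-coloring (c′ , proper′ , dominated′) =
    c , proper , dominated
    where open Uncontract c′ proper′ dominated′

  contracted-coloring : ∀ {k} → NoIsolated H → HasTDColoring G k →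
                        HasTDColoring H (1 + k) ⊎ HasTDColoring H k
  contracted-coloring noIsolated (c , proper , dominated) =
    Contract.contracted-coloring c proper dominated noIsolated

theorem3p1 : ∀ {n} (G : Graph (suc n)) (u v : Fin (suc n)) (e : Adj G u v) →
    Connected G → NoIsolated G → NoIsolated (contract G u v e) →
    ∀ k k′ → IsTDChromatic G k → IsTDChromatic (contract G u v e) k′ →
    k ≤ k′ + 2 × k′ ≤ k + 1
theorem3p1 G u v e _ _ noIsolatedH k k′ (hasG , minimalG) (hasH , minimalH) =
  subst (k ≤_) (ℕ.+-comm 2 k′) (minimalG (2 + k′) (uncontracted-coloring hasH)) ,
  subst (k′ ≤_) (ℕ.+-comm 1 k)
    ([ minimalH (1 + k) , ℕ.m≤n⇒m≤1+n ∘ minimalH k ]′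
       (contracted-coloring noIsolatedH hasG))
  where open Contraction G u v e
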